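{- Let $(u,v)$ be an alphabet and $\theta\in\{u,v\}$. If $(\alpha,\beta)$ is an alphabet such that $\alpha\beta$ is a subword of $\theta^s$ for some positive integer $s$, then $\alpha\beta$ is a subword of $\theta$ and $(u,v)$ is a child of $(\alpha,\beta)$.
   Context: Let $a=22$ and $b=11$ (words over $\{1,2\}$). For a pair of words $(u,v)$ define $\overline U(u,v)=(uv,v)$ and $\overline V(u,v)=(u,uv)$. The tree of alphabets is obtained from the root $(a,b)$ by successively applying $\overline U$ and $\overline V$; its vertices are called alphabets. An alphabet $(u,v)$ is a child of $(\alpha,\beta)$ if it is obtained from $(\alpha,\beta)$ by applying $\overline U$ or $\overline V$ successively finitely many times. A subword means a contiguous factor; $\theta^s$ is the concatenation of $s$ copies of $\theta$. -}

module Defs where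

open import Data.Nat using (ℕ; zero; suc)
open import Data.List using (List; []; _∷_; _++_)
open import Data.Product using (_×_; _,_; ∃-syntax)
open import Relation.Binary.PropositionalEquality using (_≡_)

data Letter : Set where
  𝟏 𝟐 : Letter

Word : Set
Word = List Letter

a : Word
a = 𝟐 ∷ 𝟐 ∷ []

b : Word
b = 𝟏 ∷ 𝟏 ∷ []

Pair : Set
Pair = Word × Word

Ū : Pair → Pair
Ū (u , v) = (u ++ v , v)

V̄ : Pair → Pair
V̄ (u , v) = (u , u ++ v)

data ChildOf : Pair → Pair → Set where
  here  : ∀ {p} → ChildOf p p
  stepU : ∀ {p q} → ChildOf q p → ChildOf (Ū q) p
  stepV : ∀ {p q} → ChildOf q p → ChildOf (V̄ q) p

Alphabet : Pair → Set
Alphabet p = ChildOf p (a , b)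

Subword : Word → Word → Set
Subword x w = ∃[ l ] ∃[ r ] (l ++ x ++ r ≡ w)

_^ʷ_ : Word → ℕ → Word
θ ^ʷ zero = []
θ ^ʷ suc s = θ ++ (θ ^ʷ s)

-- Every alphabet is the doubling (c ↦ cc) of a Christoffel pair, i.e. of a pair in the tree
-- generated from (𝟐 , 𝟏) by the morphisms G and D, which realise Ū and V̄ at the root and
-- commute with both.  The components of a Christoffel pair are letters or words 𝟐⋯𝟏, so
-- αβ is always a word 𝟐⋯𝟏 and never occurs in a power of a letter.  We induct on the two
-- Christoffel pairs.  At the root αβ = 𝟐𝟏, which can only occur in a power of a component
-- 𝟐⋯𝟏, and every such word contains 𝟐𝟏.  If both pairs are G-images (or both D-images), an
-- occurrence of G(αβ) in G(θ)ˢ is aligned with the blocks of G, hence comes from an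
-- occurrence of αβ in θˢ, and the induction hypothesis is mapped back by G; the doubling
-- is removed the same way at the start.  Mixed cases do not occur: G-images of words 𝟐⋯𝟏
-- contain 𝟏𝟏 while D-images never do, and dually for 𝟐𝟐.
module Submission where

open import Defs
open import Data.Nat using (ℕ; zero; suc)
open import Data.List using ([]; _∷_; _++_; concatMap)
open import Data.List.Properties
  using (++-assoc; ++-identityʳ; ++-cancelˡ; ++-conicalˡ; ++-conicalʳ;
         ∷-injectiveˡ; ∷-injectiveʳ; concatMap-++)
open import Data.Product using (_×_; _,_; ∃-syntax; proj₁; proj₂)
open import Data.Sum using (_⊎_; inj₁; inj₂)
open import Data.Empty using (⊥-elim)
open import Relation.Nullary using (¬_)
open import Relation.Binary.PropositionalEquality

private
  variable
    c d : Letter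
    r w x y z θ : Word
    f : Letter → Word
    p q : Pair

++-equidivisible : ∀ l {m p q : Word} → l ++ m ≡ p ++ q →
  (∃[ x ] ∃[ t ] (p ≡ l ++ x ∷ t × m ≡ x ∷ t ++ q)) ⊎ (∃[ t ] (l ≡ p ++ t × q ≡ t ++ m))
++-equidivisible []      {p = []}    eq = inj₂ ([] , refl , sym eq)
++-equidivisible []      {p = x ∷ p} eq = inj₁ (x , p , refl , eq)
++-equidivisible (x ∷ l) {p = []}    eq = inj₂ (x ∷ l , refl , sym eq)
++-equidivisible (x ∷ l) {m} {p = y ∷ p} eq
  with refl ← ∷-injectiveˡ eq
  with ++-equidivisible l {m} {p} (∷-injectiveʳ eq)
... | inj₁ (z , t , refl , e) = inj₁ (z , t , refl , e)
... | inj₂ (t , refl , e)     = inj₂ (t , refl , e)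

concatMap-^ʷ : ∀ f θ n → concatMap f (θ ^ʷ n) ≡ concatMap f θ ^ʷ n
concatMap-^ʷ f θ zero    = refl
concatMap-^ʷ f θ (suc n) = begin
  concatMap f (θ ++ θ ^ʷ n)               ≡⟨ concatMap-++ f θ (θ ^ʷ n) ⟩
  concatMap f θ ++ concatMap f (θ ^ʷ n)   ≡⟨ cong (concatMap f θ ++_) (concatMap-^ʷ f θ n) ⟩
  concatMap f θ ++ concatMap f θ ^ʷ n     ∎
  where open ≡-Reasoning

Subword-trans : Subword x y → Subword y z → Subword x z
Subword-trans {x} (l₁ , r₁ , refl) (l₂ , r₂ , refl) = l₂ ++ l₁ , r₁ ++ r₂ , (begin
  (l₂ ++ l₁) ++ x ++ r₁ ++ r₂    ≡⟨ ++-assoc l₂ l₁ _ ⟩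
  l₂ ++ l₁ ++ x ++ r₁ ++ r₂      ≡⟨ cong (λ v → l₂ ++ l₁ ++ v) (++-assoc x r₁ r₂) ⟨
  l₂ ++ l₁ ++ (x ++ r₁) ++ r₂    ≡⟨ cong (l₂ ++_) (++-assoc l₁ (x ++ r₁) r₂) ⟨
  l₂ ++ (l₁ ++ x ++ r₁) ++ r₂    ∎)
  where open ≡-Reasoning

Subword-++ˡ : ∀ p → Subword x w → Subword x (p ++ w)
Subword-++ˡ p (l , r , eq) = p ++ l , r , trans (++-assoc p l _) (cong (p ++_) eq)

Subword-concatMap : ∀ f → Subword x w → Subword (concatMap f x) (concatMap f w)
Subword-concatMap {x} f (l , r , refl) = concatMap f l , concatMap f r , (begin
  concatMap f l ++ concatMap f x ++ concatMap f r   ≡⟨ cong (concatMap f l ++_) (concatMap-++ f x r) ⟨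
  concatMap f l ++ concatMap f (x ++ r)             ≡⟨ concatMap-++ f l (x ++ r) ⟨
  concatMap f (l ++ x ++ r)                         ∎)
  where open ≡-Reasoning

letter-power-factor : ∀ n → Subword (d ∷ []) ((c ∷ []) ^ʷ n) → d ≡ c
letter-power-factor zero    ([]    , _ , ())
letter-power-factor zero    (_ ∷ _ , _ , ())
letter-power-factor (suc n) ([]    , _ , eq) = ∷-injectiveˡ eq
letter-power-factor (suc n) (_ ∷ l , r , eq) = letter-power-factor n (l , r , ∷-injectiveʳ eq)

data EndsWith (c : Letter) : Word → Set where
  end : EndsWith c (c ∷ [])
  _∷_ : ∀ d {w} → EndsWith c w → EndsWith c (d ∷ w)

EndsWith-++ˡ : ∀ p → EndsWith c w → EndsWith c (p ++ w)
EndsWith-++ˡ []      e = e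
EndsWith-++ˡ (d ∷ p) e = d ∷ EndsWith-++ˡ p e

EndsWith⇒Subword : EndsWith c w → Subword (c ∷ []) w
EndsWith⇒Subword end     = [] , [] , refl
EndsWith⇒Subword (d ∷ e) = Subword-++ˡ (d ∷ []) (EndsWith⇒Subword e)

EndsWith-concatMap : EndsWith d (f c) → EndsWith c w → EndsWith d (concatMap f w)
EndsWith-concatMap {f = f} {c} e end = subst (EndsWith _) (sym (++-identityʳ (f c))) e
EndsWith-concatMap {f = f} e (c′ ∷ e′) = EndsWith-++ˡ (f c′) (EndsWith-concatMap e e′)

data Begins𝟐Ends𝟏 : Word → Set where
  𝟐∷_ : EndsWith 𝟏 w → Begins𝟐Ends𝟏 (𝟐 ∷ w)

Begins𝟐Ends𝟏⇒𝟐𝟏 : Begins𝟐Ends𝟏 w → Subword (𝟐 ∷ 𝟏 ∷ []) w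
Begins𝟐Ends𝟏⇒𝟐𝟏 (𝟐∷ end)     = [] , [] , refl
Begins𝟐Ends𝟏⇒𝟐𝟏 (𝟐∷ (𝟏 ∷ _)) = [] , _ , refl
Begins𝟐Ends𝟏⇒𝟐𝟏 (𝟐∷ (𝟐 ∷ e)) = Subword-++ˡ (𝟐 ∷ []) (Begins𝟐Ends𝟏⇒𝟐𝟏 (𝟐∷ e))

Begins𝟐Ends𝟏-not-in-letter-power : ∀ n → Begins𝟐Ends𝟏 w → ¬ Subword w ((c ∷ []) ^ʷ n)
Begins𝟐Ends𝟏-not-in-letter-power n (𝟐∷ e) sub
  with letter-power-factor n (Subword-trans ([] , _ , refl) sub)
     | letter-power-factor n (Subword-trans (Subword-++ˡ (𝟐 ∷ []) (EndsWith⇒Subword e)) sub)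
... | refl | ()

ComponentShape : Letter → Word → Set
ComponentShape c w = w ≡ c ∷ [] ⊎ Begins𝟐Ends𝟏 w

ComponentShape𝟏⇒EndsWith𝟏 : ComponentShape 𝟏 w → EndsWith 𝟏 w
ComponentShape𝟏⇒EndsWith𝟏 (inj₁ refl)     = end
ComponentShape𝟏⇒EndsWith𝟏 (inj₂ (𝟐∷ e)) = 𝟐 ∷ e

Begins𝟐Ends𝟏-++ : ComponentShape 𝟐 x → ComponentShape 𝟏 y → Begins𝟐Ends𝟏 (x ++ y)
Begins𝟐Ends𝟏-++ (inj₁ refl)             sy = 𝟐∷ ComponentShape𝟏⇒EndsWith𝟏 sy
Begins𝟐Ends𝟏-++ (inj₂ (𝟐∷_ {w} _)) sy = 𝟐∷ EndsWith-++ˡ w (ComponentShape𝟏⇒EndsWith𝟏 sy)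

Begins𝟐Ends𝟏-factor-of-power : ∀ n → ComponentShape c θ → Begins𝟐Ends𝟏 w →
  Subword w (θ ^ʷ n) → Begins𝟐Ends𝟏 θ
Begins𝟐Ends𝟏-factor-of-power n (inj₁ refl) m sub =
  ⊥-elim (Begins𝟐Ends𝟏-not-in-letter-power n m sub)
Begins𝟐Ends𝟏-factor-of-power n (inj₂ mθ)   m sub = mθ

mapᵖ : (Letter → Word) → Pair → Pair
mapᵖ f (x , y) = concatMap f x , concatMap f y

concatᵖ : Pair → Word
concatᵖ (x , y) = x ++ y

_∈ᵖ_ : Word → Pair → Set
θ ∈ᵖ (u , v) = θ ≡ u ⊎ θ ≡ v

mapᵖ-Ū : ∀ f p → mapᵖ f (Ū p) ≡ Ū (mapᵖ f p)
mapᵖ-Ū f (x , y) = cong (_, concatMap f y) (concatMap-++ f x y)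

mapᵖ-V̄ : ∀ f p → mapᵖ f (V̄ p) ≡ V̄ (mapᵖ f p)
mapᵖ-V̄ f (x , y) = cong (concatMap f x ,_) (concatMap-++ f x y)

concatᵖ-mapᵖ : ∀ f p → concatᵖ (mapᵖ f p) ≡ concatMap f (concatᵖ p)
concatᵖ-mapᵖ f (x , y) = sym (concatMap-++ f x y)

∈ᵖ-mapᵖ⁻ : ∀ p → θ ∈ᵖ mapᵖ f p → ∃[ θ′ ] (θ ≡ concatMap f θ′ × θ′ ∈ᵖ p)
∈ᵖ-mapᵖ⁻ (x , y) (inj₁ refl) = x , refl , inj₁ refl
∈ᵖ-mapᵖ⁻ (x , y) (inj₂ refl) = y , refl , inj₂ refl

ChildOf-trans : ∀ {p q r} → ChildOf q p → ChildOf p r → ChildOf q r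
ChildOf-trans here      c′ = c′
ChildOf-trans (stepU c) c′ = stepU (ChildOf-trans c c′)
ChildOf-trans (stepV c) c′ = stepV (ChildOf-trans c c′)

ChildOf-mapᵖ : ∀ f {p q} → ChildOf q p → ChildOf (mapᵖ f q) (mapᵖ f p)
ChildOf-mapᵖ f here               = here
ChildOf-mapᵖ f (stepU {q = q} c) =
  subst (λ q′ → ChildOf q′ _) (sym (mapᵖ-Ū f q)) (stepU (ChildOf-mapᵖ f c))
ChildOf-mapᵖ f (stepV {q = q} c) =
  subst (λ q′ → ChildOf q′ _) (sym (mapᵖ-V̄ f q)) (stepV (ChildOf-mapᵖ f c))

-- The morphisms

G D double : Letter → Word
G 𝟐 = 𝟐 ∷ 𝟏 ∷ []
G 𝟏 = 𝟏 ∷ []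
D 𝟐 = 𝟐 ∷ []
D 𝟏 = 𝟐 ∷ 𝟏 ∷ []
double c = c ∷ c ∷ []

Begins𝟐Ends𝟏-G : Begins𝟐Ends𝟏 w → Begins𝟐Ends𝟏 (concatMap G w)
Begins𝟐Ends𝟏-G (𝟐∷ e) = 𝟐∷ (𝟏 ∷ EndsWith-concatMap {f = G} end e)

Begins𝟐Ends𝟏-D : Begins𝟐Ends𝟏 w → Begins𝟐Ends𝟏 (concatMap D w)
Begins𝟐Ends𝟏-D (𝟐∷ e) = 𝟐∷ EndsWith-concatMap {f = D} (𝟐 ∷ end) e

ComponentShape-concatMap : ∀ f → (∀ {w} → Begins𝟐Ends𝟏 w → Begins𝟐Ends𝟏 (concatMap f w)) →
  ComponentShape c (concatMap f (c ∷ [])) →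
  ComponentShape c w → ComponentShape c (concatMap f w)
ComponentShape-concatMap f preserves letter (inj₁ refl) = letter
ComponentShape-concatMap f preserves letter (inj₂ m)    = inj₂ (preserves m)

G-image-contains-𝟏𝟏 : ∀ c → EndsWith 𝟏 w → Subword (𝟏 ∷ 𝟏 ∷ []) (concatMap G (c ∷ w))
G-image-contains-𝟏𝟏 𝟏 end     = [] , [] , refl
G-image-contains-𝟏𝟏 𝟐 end     = 𝟐 ∷ [] , [] , refl
G-image-contains-𝟏𝟏 c (d ∷ e) = Subword-++ˡ (G c) (G-image-contains-𝟏𝟏 d e)

D-image-contains-𝟐𝟐 : EndsWith 𝟏 w → Subword (𝟐 ∷ 𝟐 ∷ []) (concatMap D (𝟐 ∷ w))
D-image-contains-𝟐𝟐 end     = [] , 𝟏 ∷ [] , refl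
D-image-contains-𝟐𝟐 (𝟐 ∷ _) = [] , _ , refl
D-image-contains-𝟐𝟐 (𝟏 ∷ _) = [] , _ , refl

𝟏-not-first-in-D-image : ∀ y → 𝟏 ∷ r ≢ concatMap D y
𝟏-not-first-in-D-image []      ()
𝟏-not-first-in-D-image (𝟐 ∷ _) ()
𝟏-not-first-in-D-image (𝟏 ∷ _) ()

𝟏𝟏-not-in-D-image : ∀ y → ¬ Subword (𝟏 ∷ 𝟏 ∷ []) (concatMap D y)
𝟏𝟏-not-in-D-image []      ([]    , _ , ())
𝟏𝟏-not-in-D-image []      (_ ∷ _ , _ , ())
𝟏𝟏-not-in-D-image (𝟐 ∷ y) ([]    , _ , ())
𝟏𝟏-not-in-D-image (𝟐 ∷ y) (_ ∷ l , r , eq) = 𝟏𝟏-not-in-D-image y (l , r , ∷-injectiveʳ eq)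
𝟏𝟏-not-in-D-image (𝟏 ∷ y) ([]    , _ , ())
𝟏𝟏-not-in-D-image (𝟏 ∷ y) (_ ∷ [] , _ , eq) =
  𝟏-not-first-in-D-image y (∷-injectiveʳ (∷-injectiveʳ eq))
𝟏𝟏-not-in-D-image (𝟏 ∷ y) (_ ∷ _ ∷ l , r , eq) =
  𝟏𝟏-not-in-D-image y (l , r , ∷-injectiveʳ (∷-injectiveʳ eq))

𝟐𝟐-not-in-G-image : ∀ y → ¬ Subword (𝟐 ∷ 𝟐 ∷ []) (concatMap G y)
𝟐𝟐-not-in-G-image []      ([]    , _ , ())
𝟐𝟐-not-in-G-image []      (_ ∷ _ , _ , ())
𝟐𝟐-not-in-G-image (𝟏 ∷ y) ([]    , _ , ())
𝟐𝟐-not-in-G-image (𝟏 ∷ y) (_ ∷ l , r , eq) = 𝟐𝟐-not-in-G-image y (l , r , ∷-injectiveʳ eq)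
𝟐𝟐-not-in-G-image (𝟐 ∷ y) ([]    , _ , ())
𝟐𝟐-not-in-G-image (𝟐 ∷ y) (_ ∷ [] , _ , ())
𝟐𝟐-not-in-G-image (𝟐 ∷ y) (_ ∷ _ ∷ l , r , eq) =
  𝟐𝟐-not-in-G-image y (l , r , ∷-injectiveʳ (∷-injectiveʳ eq))

G-image-not-in-D-image : Begins𝟐Ends𝟏 w → ∀ y → ¬ Subword (concatMap G w) (concatMap D y)
G-image-not-in-D-image (𝟐∷ e) y sub =
  𝟏𝟏-not-in-D-image y (Subword-trans (G-image-contains-𝟏𝟏 𝟐 e) sub)

D-image-not-in-G-image : Begins𝟐Ends𝟏 w → ∀ y → ¬ Subword (concatMap D w) (concatMap G y)
D-image-not-in-G-image (𝟐∷ e) y sub =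
  𝟐𝟐-not-in-G-image y (Subword-trans (D-image-contains-𝟐𝟐 e) sub)

-- Desubstitution

Desubstitutable : (Letter → Word) → Word → Set
Desubstitutable f x = ∀ {y} → Subword (concatMap f x) (concatMap f y) → Subword x y

Synchronizing : (Letter → Word) → Word → Set
Synchronizing f x = ∀ {l r y} → l ++ concatMap f x ++ r ≡ concatMap f y →
  ∃[ y₁ ] ∃[ y₂ ] (y ≡ y₁ ++ y₂ × concatMap f x ++ r ≡ concatMap f y₂)

PrefixDecodable : (Letter → Word) → Word → Set
PrefixDecodable f x = ∀ {r y} → concatMap f x ++ r ≡ concatMap f y → ∃[ y′ ] (y ≡ x ++ y′)

desubstitutable : Synchronizing f x → PrefixDecodable f x → Desubstitutable f x
desubstitutable sync decode {y} (l , r , eq) with sync {l} {r} {y} eq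
... | y₁ , y₂ , refl , eq₂ with decode {y = y₂} eq₂
... | y′ , refl = y₁ , y′ , refl

SynchronizingLetter : (Letter → Word) → Letter → Set
SynchronizingLetter f c = ∀ d {l r} → l ++ c ∷ r ≡ f d → l ≡ []

letter-synchronizes : SynchronizingLetter f c → ∀ {l w y} → l ++ c ∷ w ≡ concatMap f y →
  ∃[ y₁ ] ∃[ y₂ ] (y ≡ y₁ ++ y₂ × c ∷ w ≡ concatMap f y₂)
letter-synchronizes sync {l} {y = []} eq with () ← ++-conicalʳ l _ eq
letter-synchronizes {f = f} sync {l} {y = d ∷ y} eq with ++-equidivisible l {p = f d} eq
... | inj₁ (_ , _ , fd≡ , refl) with refl ← sync d (sym fd≡) = [] , d ∷ y , refl , eq
... | inj₂ (t , refl , e) with letter-synchronizes sync {t} {y = y} (sym e)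
...   | y₁ , y₂ , refl , eq₂ = d ∷ y₁ , y₂ , refl , eq₂

record PrefixCode (f : Letter → Word) : Set where
  field
    nonempty    : ∀ c → f c ≢ []
    first-block : ∀ {c d r s} → f c ++ r ≡ f d ++ s → c ≡ d

prefixCode-decodable : PrefixCode f → ∀ x → PrefixDecodable f x
prefixCode-decodable code []      {y = y}    eq = y , refl
prefixCode-decodable code (c ∷ x) {y = []}   eq =
  ⊥-elim (PrefixCode.nonempty code c (++-conicalˡ _ _ (++-conicalˡ _ _ eq)))
prefixCode-decodable {f = f} code (c ∷ x) {r} {d ∷ y} eq
  with eq′ ← trans (sym (++-assoc (f c) (concatMap f x) r)) eq
  with refl ← PrefixCode.first-block code eq′
  with y′ , refl ← prefixCode-decodable code x {y = y} (++-cancelˡ (f c) _ _ eq′)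
  = y′ , refl

𝟐-synchronizes-G : SynchronizingLetter G 𝟐
𝟐-synchronizes-G 𝟐 {[]}             _  = refl
𝟐-synchronizes-G 𝟐 {_ ∷ []}         ()
𝟐-synchronizes-G 𝟐 {_ ∷ _ ∷ []}     ()
𝟐-synchronizes-G 𝟐 {_ ∷ _ ∷ _ ∷ _}  ()
𝟐-synchronizes-G 𝟏 {[]}             ()
𝟐-synchronizes-G 𝟏 {_ ∷ []}         ()
𝟐-synchronizes-G 𝟏 {_ ∷ _ ∷ _}      ()

𝟐-synchronizes-D : SynchronizingLetter D 𝟐
𝟐-synchronizes-D 𝟐 {[]}             _  = refl
𝟐-synchronizes-D 𝟐 {_ ∷ []}         ()
𝟐-synchronizes-D 𝟐 {_ ∷ _ ∷ _}      ()
𝟐-synchronizes-D 𝟏 {[]}             _  = refl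
𝟐-synchronizes-D 𝟏 {_ ∷ []}         ()
𝟐-synchronizes-D 𝟏 {_ ∷ _ ∷ []}     ()
𝟐-synchronizes-D 𝟏 {_ ∷ _ ∷ _ ∷ _}  ()

G-prefixCode : PrefixCode G
G-prefixCode = record { nonempty = λ { 𝟐 () ; 𝟏 () } ; first-block = first-block }
  where
  first-block : ∀ {c d r s} → G c ++ r ≡ G d ++ s → c ≡ d
  first-block {𝟐} {𝟐} _ = refl
  first-block {𝟏} {𝟏} _ = refl
  first-block {𝟐} {𝟏} ()
  first-block {𝟏} {𝟐} ()

double-prefixCode : PrefixCode double
double-prefixCode = record { nonempty = λ _ () ; first-block = ∷-injectiveˡ }

D-prefix-decodable : EndsWith 𝟏 x → PrefixDecodable D x
D-prefix-decodable end           {y = []}    ()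
D-prefix-decodable (𝟏 ∷ _)       {y = []}    ()
D-prefix-decodable (𝟐 ∷ _)       {y = []}    ()
D-prefix-decodable end           {y = 𝟏 ∷ y} _  = y , refl
D-prefix-decodable end           {y = 𝟐 ∷ y} eq =
  ⊥-elim (𝟏-not-first-in-D-image y (∷-injectiveʳ eq))
D-prefix-decodable (𝟏 ∷ e)       {y = 𝟏 ∷ y} eq
  with y′ , refl ← D-prefix-decodable e {y = y} (∷-injectiveʳ (∷-injectiveʳ eq)) = y′ , refl
D-prefix-decodable (𝟏 ∷ e)       {y = 𝟐 ∷ y} eq =
  ⊥-elim (𝟏-not-first-in-D-image y (∷-injectiveʳ eq))
D-prefix-decodable (𝟐 ∷ e)       {y = 𝟐 ∷ y} eq
  with y′ , refl ← D-prefix-decodable e {y = y} (∷-injectiveʳ eq) = y′ , refl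
D-prefix-decodable (𝟐 ∷ end)     {y = 𝟏 ∷ y} ()
D-prefix-decodable (𝟐 ∷ (𝟐 ∷ _)) {y = 𝟏 ∷ y} ()
D-prefix-decodable (𝟐 ∷ (𝟏 ∷ _)) {y = 𝟏 ∷ y} ()

-- Read at an odd offset, a doubled word pairs each letter with its successor.
double-misaligned : EndsWith d z → c ∷ (concatMap double z ++ r) ≡ concatMap double y → c ≡ d
double-misaligned {y = _ ∷ _} end eq
  with refl ← ∷-injectiveˡ eq | refl ← ∷-injectiveˡ (∷-injectiveʳ eq) = refl
double-misaligned {y = _ ∷ y} (_ ∷ e) eq
  with refl ← ∷-injectiveˡ eq | refl ← ∷-injectiveˡ (∷-injectiveʳ eq) =
  double-misaligned {y = y} e (∷-injectiveʳ (∷-injectiveʳ eq))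

double-synchronizing : EndsWith 𝟏 w → Synchronizing double (𝟐 ∷ w)
double-synchronizing e {[]} {y = y} eq = [] , y , refl , eq
double-synchronizing e {_ ∷ _} {y = []} ()
double-synchronizing e {_ ∷ []} {y = _ ∷ y} eq
  with () ← double-misaligned {y = y} e (∷-injectiveʳ (∷-injectiveʳ eq))
double-synchronizing e {_ ∷ _ ∷ l} {y = c ∷ y} eq
  with y₁ , y₂ , refl , eq₂ ←
         double-synchronizing e {l} {y = y} (∷-injectiveʳ (∷-injectiveʳ eq))
  = c ∷ y₁ , y₂ , refl , eq₂

G-desubstitutable : Begins𝟐Ends𝟏 x → Desubstitutable G x
G-desubstitutable (𝟐∷ _) =
  desubstitutable (letter-synchronizes 𝟐-synchronizes-G) (prefixCode-decodable G-prefixCode _)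

D-desubstitutable : Begins𝟐Ends𝟏 x → Desubstitutable D x
D-desubstitutable (𝟐∷ e) =
  desubstitutable (letter-synchronizes 𝟐-synchronizes-D) (D-prefix-decodable (𝟐 ∷ e))

double-desubstitutable : Begins𝟐Ends𝟏 x → Desubstitutable double x
double-desubstitutable (𝟐∷ e) =
  desubstitutable (double-synchronizing e) (prefixCode-decodable double-prefixCode _)

-- Christoffel pairs

data ChristoffelPair : Pair → Set where
  root    : ChristoffelPair (𝟐 ∷ [] , 𝟏 ∷ [])
  G-image : ∀ {p} → ChristoffelPair p → ChristoffelPair (mapᵖ G p)
  D-image : ∀ {p} → ChristoffelPair p → ChristoffelPair (mapᵖ D p)

ChristoffelPair-Ū : ChristoffelPair p → ChristoffelPair (Ū p)
ChristoffelPair-Ū root            = G-image root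
ChristoffelPair-Ū (G-image {p} t) =
  subst ChristoffelPair (mapᵖ-Ū G p) (G-image (ChristoffelPair-Ū t))
ChristoffelPair-Ū (D-image {p} t) =
  subst ChristoffelPair (mapᵖ-Ū D p) (D-image (ChristoffelPair-Ū t))

ChristoffelPair-V̄ : ChristoffelPair p → ChristoffelPair (V̄ p)
ChristoffelPair-V̄ root            = D-image root
ChristoffelPair-V̄ (G-image {p} t) =
  subst ChristoffelPair (mapᵖ-V̄ G p) (G-image (ChristoffelPair-V̄ t))
ChristoffelPair-V̄ (D-image {p} t) =
  subst ChristoffelPair (mapᵖ-V̄ D p) (D-image (ChristoffelPair-V̄ t))

ChristoffelPair⇒ChildOf-root : ChristoffelPair p → ChildOf p (𝟐 ∷ [] , 𝟏 ∷ [])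
ChristoffelPair⇒ChildOf-root root        = here
ChristoffelPair⇒ChildOf-root (G-image t) =
  ChildOf-trans (ChildOf-mapᵖ G (ChristoffelPair⇒ChildOf-root t)) (stepU here)
ChristoffelPair⇒ChildOf-root (D-image t) =
  ChildOf-trans (ChildOf-mapᵖ D (ChristoffelPair⇒ChildOf-root t)) (stepV here)

Alphabet⇒double-ChristoffelPair : Alphabet p → ∃[ q ] (ChristoffelPair q × p ≡ mapᵖ double q)
Alphabet⇒double-ChristoffelPair here = _ , root , refl
Alphabet⇒double-ChristoffelPair (stepU c) with q , t , refl ← Alphabet⇒double-ChristoffelPair c =
  Ū q , ChristoffelPair-Ū t , sym (mapᵖ-Ū double q)
Alphabet⇒double-ChristoffelPair (stepV c) with q , t , refl ← Alphabet⇒double-ChristoffelPair c =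
  V̄ q , ChristoffelPair-V̄ t , sym (mapᵖ-V̄ double q)

ChristoffelPair-shape : ChristoffelPair p →
  ComponentShape 𝟐 (proj₁ p) × ComponentShape 𝟏 (proj₂ p)
ChristoffelPair-shape root = inj₁ refl , inj₁ refl
ChristoffelPair-shape (G-image t) with sx , sy ← ChristoffelPair-shape t =
  ComponentShape-concatMap G Begins𝟐Ends𝟏-G (inj₂ (𝟐∷ end)) sx ,
  ComponentShape-concatMap G Begins𝟐Ends𝟏-G (inj₁ refl) sy
ChristoffelPair-shape (D-image t) with sx , sy ← ChristoffelPair-shape t =
  ComponentShape-concatMap D Begins𝟐Ends𝟏-D (inj₁ refl) sx ,
  ComponentShape-concatMap D Begins𝟐Ends𝟏-D (inj₂ (𝟐∷ end)) sy

ChristoffelPair-Begins𝟐Ends𝟏 : ChristoffelPair p → Begins𝟐Ends𝟏 (concatᵖ p)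
ChristoffelPair-Begins𝟐Ends𝟏 t with sx , sy ← ChristoffelPair-shape t = Begins𝟐Ends𝟏-++ sx sy

component-Begins𝟐Ends𝟏 : ∀ n → ChristoffelPair q → θ ∈ᵖ q → Begins𝟐Ends𝟏 w →
  Subword w (θ ^ʷ n) → Begins𝟐Ends𝟏 θ
component-Begins𝟐Ends𝟏 n t (inj₁ refl) =
  Begins𝟐Ends𝟏-factor-of-power n (proj₁ (ChristoffelPair-shape t))
component-Begins𝟐Ends𝟏 n t (inj₂ refl) =
  Begins𝟐Ends𝟏-factor-of-power n (proj₂ (ChristoffelPair-shape t))

-- The descent property

FactorOfPower⇒Child : Pair → Pair → Set
FactorOfPower⇒Child p q = ∀ {θ} n → θ ∈ᵖ q → Subword (concatᵖ p) (θ ^ʷ suc n) →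
  Subword (concatᵖ p) θ × ChildOf q p

FactorOfPower⇒Child-mapᵖ : ∀ f {p q} → Desubstitutable f (concatᵖ p) →
  FactorOfPower⇒Child p q → FactorOfPower⇒Child (mapᵖ f p) (mapᵖ f q)
FactorOfPower⇒Child-mapᵖ f {p} {q} desub descent n θ∈ sub
  with θ′ , refl , θ′∈ ← ∈ᵖ-mapᵖ⁻ q θ∈
  with factor , child ← descent n θ′∈
         (desub (subst₂ Subword (concatᵖ-mapᵖ f p) (sym (concatMap-^ʷ f θ′ (suc n))) sub))
  = subst (λ v → Subword v _) (sym (concatᵖ-mapᵖ f p)) (Subword-concatMap f factor)
  , ChildOf-mapᵖ f child

FactorOfPower⇒Child-disjoint : ∀ f g {p q} →
  (∀ y → ¬ Subword (concatMap f (concatᵖ p)) (concatMap g y)) →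
  FactorOfPower⇒Child (mapᵖ f p) (mapᵖ g q)
FactorOfPower⇒Child-disjoint f g {p} {q} disjoint n θ∈ sub
  with θ′ , refl , _ ← ∈ᵖ-mapᵖ⁻ q θ∈
  = ⊥-elim (disjoint (θ′ ^ʷ suc n)
      (subst₂ Subword (concatᵖ-mapᵖ f p) (sym (concatMap-^ʷ g θ′ (suc n))) sub))

ChristoffelPair-descent : ChristoffelPair p → ChristoffelPair q → FactorOfPower⇒Child p q
ChristoffelPair-descent root tq n θ∈ sub =
  Begins𝟐Ends𝟏⇒𝟐𝟏 (component-Begins𝟐Ends𝟏 (suc n) tq θ∈ (𝟐∷ end) sub)
  , ChristoffelPair⇒ChildOf-root tq
ChristoffelPair-descent tp root n (inj₁ refl) sub =
  ⊥-elim (Begins𝟐Ends𝟏-not-in-letter-power (suc n) (ChristoffelPair-Begins𝟐Ends𝟏 tp) sub)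
ChristoffelPair-descent tp root n (inj₂ refl) sub =
  ⊥-elim (Begins𝟐Ends𝟏-not-in-letter-power (suc n) (ChristoffelPair-Begins𝟐Ends𝟏 tp) sub)
ChristoffelPair-descent (G-image tp) (G-image tq) =
  FactorOfPower⇒Child-mapᵖ G (G-desubstitutable (ChristoffelPair-Begins𝟐Ends𝟏 tp))
    (ChristoffelPair-descent tp tq)
ChristoffelPair-descent (D-image tp) (D-image tq) =
  FactorOfPower⇒Child-mapᵖ D (D-desubstitutable (ChristoffelPair-Begins𝟐Ends𝟏 tp))
    (ChristoffelPair-descent tp tq)
ChristoffelPair-descent (G-image {p} tp) (D-image {q} tq) =
  FactorOfPower⇒Child-disjoint G D {p} {q}
    (G-image-not-in-D-image (ChristoffelPair-Begins𝟐Ends𝟏 tp))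
ChristoffelPair-descent (D-image {p} tp) (G-image {q} tq) =
  FactorOfPower⇒Child-disjoint D G {p} {q}
    (D-image-not-in-G-image (ChristoffelPair-Begins𝟐Ends𝟏 tp))

Alphabet-descent : Alphabet p → Alphabet q → FactorOfPower⇒Child p q
Alphabet-descent ap aq
  with p , tp , refl ← Alphabet⇒double-ChristoffelPair ap
     | q , tq , refl ← Alphabet⇒double-ChristoffelPair aq
  = FactorOfPower⇒Child-mapᵖ double (double-desubstitutable (ChristoffelPair-Begins𝟐Ends𝟏 tp))
      (ChristoffelPair-descent tp tq)

lemma2p14 : (u v θ α β : Word) → Alphabet (u , v) → (θ ≡ u ⊎ θ ≡ v) →
    Alphabet (α , β) → (s : ℕ) → Subword (α ++ β) (θ ^ʷ suc s) →
    Subword (α ++ β) θ × ChildOf (u , v) (α , β)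
lemma2p14 u v θ α β alphabet-uv θ∈ alphabet-αβ s =
  Alphabet-descent alphabet-αβ alphabet-uv s θ∈
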